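{- Let $\mathbf{h}$ be a weakly increasing sequence of positive integers with $\mathbf{h}(i)>i$ for all $i$, let $S$ be a nonempty $\mathbf{h}$-admissible set and $m=\mathbf{m}(S)$. For all $n\ge\mathbf{h}(m)$, $$\mathcal{I}_\mathbf{h}(S,n;q)=\sum_{k=\mathbf{h}(m)-m}^{\mathbf{h}(m)} b_k(S;q)\begin{bmatrix} n-k\\ \mathbf{h}(m)-k\end{bmatrix}_q=\sum_{\ell=0}^{m} b_{\mathbf{h}(m)-\ell}(S;q)\begin{bmatrix} n-\mathbf{h}(m)+\ell\\ \ell\end{bmatrix}_q,$$ where $b_k(S;q)=\sum_{\pi\in B_k(S,\mathbf{h}(m))}q^{\ell(\pi)}$.
   Context: $\mathcal{P}_\mathbf{h}=\{(i,j): i<j\le \mathbf{h}(i)\}$. For $\pi\in S_n$, $\mathrm{inv}_\mathbf{h}(\pi)=\{(i,j)\in\mathcal{P}_\mathbf{h}: j\le n,\ \pi_i>\pi_j\}$. $S$ is $\mathbf{h}$-admissible if $S=\mathrm{inv}_\mathbf{h}(\pi)$ for some permutation $\pi$. $I_\mathbf{h}(S,n)=\{\pi\in S_n:\mathrm{inv}_\mathbf{h}(\pi)=S\}$. $\mathbf{m}(S)=\max\{i:(i,i+1)\in S\}$. $B_k(S,n)=\{\pi\in I_\mathbf{h}(S,n):\pi_{\mathbf{h}(m)}=k\}$. $\ell(\pi)$ is the number of inversions of $\pi$. $\mathcal{I}_\mathbf{h}(S,n;q)=\sum_{\pi\in I_\mathbf{h}(S,n)}q^{\ell(\pi)}$.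 The $q$-binomial coefficient is $\begin{bmatrix} n\\ k\end{bmatrix}_q=\frac{[n]!_q}{[n-k]!_q[k]!_q}$ with $[n]!_q=\prod_{r=1}^{n}(1+q+\cdots+q^{r-1})$. -}

module Defs where

open import Data.Nat using (ℕ; zero; suc; _+_; _*_; _∸_; _^_; _≤_; _<_; _≡ᵇ_; _<ᵇ_; _≤ᵇ_; NonZero; >-nonZero; s≤s; z≤n)
open import Data.Nat.Properties using (_≟_)
open import Data.Nat.DivMod using (_/_)
open import Data.Bool using (Bool; true; false; _∧_; _∨_; if_then_else_)
open import Data.List using (List; []; _∷_; map; filter; concatMap; upTo; length)
open import Data.Nat.ListAction using (sum)
open import Data.Bool.ListAction using (all; any)
open import Data.Product using (_×_; _,_)
open import Relation.Nullary using (does)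
import Data.List.Relation.Unary.Unique.DecPropositional as UDec

-- [a .. b] (inclusive; empty if b < a)
fromTo : ℕ → ℕ → List ℕ
fromTo a b = map (λ i → a + i) (upTo (suc b ∸ a))

sumFromTo : ℕ → ℕ → (ℕ → ℕ) → ℕ
sumFromTo a b f = sum (map f (fromTo a b))

-- Permutations in one-line notation: a permutation π ∈ S_n is the
-- list [π_1, …, π_n] of the values 1..n, each occurring exactly once.

words : ℕ → ℕ → List (List ℕ)
words zero    n = [] ∷ []
words (suc k) n = concatMap (λ a → map (a ∷_) (words k n)) (fromTo 1 n)

Sn : ℕ → List (List ℕ)
Sn n = filter (λ w → UDec.unique? _≟_ w) (words n n)

-- π_i (1-indexed); 0 outside the range 1..length π
at : List ℕ → ℕ → ℕ
at []       _             = 0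
at (x ∷ xs) zero          = 0
at (x ∷ xs) (suc zero)    = x
at (x ∷ xs) (suc (suc i)) = at xs (suc i)

invCount : List ℕ → ℕ
invCount π =
  sum (map (λ i → sum (map (λ j → if at π j <ᵇ at π i then 1 else 0)
                           (fromTo (suc i) (length π))))
           (fromTo 1 (length π)))

invH : (ℕ → ℕ) → List ℕ → List (ℕ × ℕ)
invH h π =
  concatMap (λ i → concatMap (λ j → if (j ≤ᵇ h i) ∧ (at π j <ᵇ at π i)
                                      then (i , j) ∷ [] else [])
                             (fromTo (suc i) (length π)))
            (fromTo 1 (length π))

_∈ᵇ_ : ℕ × ℕ → List (ℕ × ℕ) → Bool
(a , b) ∈ᵇ xs = any (λ { (c , d) → (a ≡ᵇ c) ∧ (b ≡ᵇ d) }) xs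

sameSet : List (ℕ × ℕ) → List (ℕ × ℕ) → Bool
sameSet xs ys = all (λ p → p ∈ᵇ ys) xs ∧ all (λ p → p ∈ᵇ xs) ys

Ih : (ℕ → ℕ) → List (ℕ × ℕ) → ℕ → List (List ℕ)
Ih h S n = filter (λ π → Data.Bool._≟_ (sameSet (invH h π) S) true) (Sn n)
  where import Data.Bool

IhPoly : (ℕ → ℕ) → List (ℕ × ℕ) → ℕ → ℕ → ℕ
IhPoly h S n q = sum (map (λ π → q ^ invCount π) (Ih h S n))

Bk : (ℕ → ℕ) → List (ℕ × ℕ) → ℕ → ℕ → ℕ → List (List ℕ)
Bk h S m k n = filter (λ π → k ≟ at π (h m)) (Ih h S n)

bk : (ℕ → ℕ) → List (ℕ × ℕ) → ℕ → ℕ → ℕ → ℕ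
bk h S m k q = sum (map (λ π → q ^ invCount π) (Bk h S m k (h m)))

-- q-analogues, evaluated at q ∈ ℕ

qint : ℕ → ℕ → ℕ
qint r q = sum (map (q ^_) (upTo r))

qfact : ℕ → ℕ → ℕ
qfact zero    q = 1
qfact (suc n) q = qfact n q * qint (suc n) q

qint-pos : ∀ r q → 0 < qint (suc r) q
qint-pos r q = s≤s z≤n

qfact-pos : ∀ n q → 0 < qfact n q
qfact-pos zero    q = s≤s z≤n
qfact-pos (suc n) q = *-pos (qfact-pos n q) (qint-pos n q)
  where
  *-pos : ∀ {a b} → 0 < a → 0 < b → 0 < a * b
  *-pos {suc a} {suc b} _ _ = s≤s z≤n

-- q-binomial [n choose k]_q = [n]!_q / ([n-k]!_q [k]!_q)
-- (the division is exact; denominator is a positive natural number)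
qbinom : ℕ → ℕ → ℕ → ℕ
qbinom n k q = _/_ (qfact n q) (qfact (n ∸ k) q * qfact k q)
                 {{>-nonZero (pos (qfact-pos (n ∸ k) q) (qfact-pos k q))}}
  where
  pos : ∀ {a b} → 0 < a → 0 < b → 0 < a * b
  pos {suc a} {suc b} _ _ = s≤s z≤n

{-# OPTIONS --safe #-}
module Submission where

-- For a weight Φ on the last entry, consider the sum of q^ℓ(π) Φ(π_n) over π ∈ I_h(S,n).
-- Every permutation of 1..n+1 arises exactly once from some π ∈ S_n and v ≤ n+1 by shifting
-- the entries ≥ v of π up by one and appending v, which adds n+1-v inversions.  Since every
-- (i,i+1) ∈ S has i ≤ m, a permutation in I_h(S,n) has no descent after position m; hence the
-- pairs of S with i ≤ m end by h(i) ≤ h(m), and there are none with i > m.  So for n ≥ h(m)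
-- the new permutation lies in I_h(S,n+1) iff π ∈ I_h(S,n) and π_n < v.  The sum at length
-- n+1 is therefore the sum at length n for the weight c ↦ Σ_{v>c} q^{n+1-v} Φ(v), and by the
-- q-hockey-stick identity this turns the weight x ↦ [n+1-x+t choose t]_q into
-- x ↦ [n-x+t+1 choose t+1]_q.  Starting from t = 0 at length n we reach t = n - h(m) at
-- length h(m).  There the entries after position m increase strictly, so π_{h(m)} ≥ h(m) - m,
-- and grouping by k = π_{h(m)} gives the b_k.

open import Defs
open import Data.Nat using (ℕ; suc; _+_; _*_; _∸_; _≤_; _<_)
open import Data.List using (List; [])
open import Data.List.Membership.Propositional using (_∈_)
open import Data.Product using (_×_; _,_; Σ)
open import Data.Bool using (T)
open import Relation.Binary.PropositionalEquality using (_≡_; _≢_)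

open import Level using (Level)
open import Function using (_∘_; Equivalence; _⟨_⟩_)
open import Data.Nat using (zero; _^_; _<ᵇ_; _≤ᵇ_; _≡ᵇ_; z≤n; s≤s; z<s; s<s; _≤′_; ≤′-refl; ≤′-step; NonZero; >-nonZero)
open import Data.Nat.Properties
open import Data.Nat.ListAction using (sum)
open import Data.Nat.DivMod using (_/_; m*n/n≡m)
open import Data.Nat.ListAction.Properties using (sum-++)
open import Data.Bool using (Bool; true; false; not; _∧_; if_then_else_)
import Data.Bool as Bool
open import Data.Bool.Properties using (T-∧; T-≡; ∧-identityʳ)
open import Data.List using (_∷_; _++_; [_]; map; concatMap; filter; applyUpTo; upTo; length)
open import Data.List.Properties using (map-++; map-∘; length-map; length-++)
open import Data.List.Relation.Unary.All as All using (All; []; _∷_)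
open import Data.List.Relation.Unary.All.Properties using (all⁺; all⁻; ¬Any⇒All¬; All¬⇒¬Any; ++⁻ˡ; ++⁻ʳ)
open import Data.List.Relation.Unary.Any as Any using (here; there)
open import Data.List.Relation.Unary.Any.Properties using (any⁺; any⁻)
open import Data.List.Relation.Binary.Subset.Propositional using (_⊆_)
open import Data.List.Relation.Unary.AllPairs using ([]; _∷_)
import Data.List.Relation.Unary.AllPairs.Properties as AllPairs
open import Data.List.Relation.Unary.Unique.Propositional using (Unique)
import Data.List.Relation.Unary.Unique.Propositional.Properties as Unique
import Data.List.Relation.Unary.Unique.DecPropositional as UniqueDec
open import Data.List.Membership.Propositional using (_∉_; find; lose)
open import Data.List.Membership.Propositional.Properties using (∈-map⁺; ∈-map⁻; ∈-upTo⁺; ∈-upTo⁻; ∈-concatMap⁺; ∈-concatMap⁻)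
open import Data.Bool.ListAction using (all)
open import Data.Product using (proj₁; proj₂)
open import Data.Empty using (⊥-elim)
open import Relation.Nullary using (does; yes; no; ¬_)
open import Relation.Nullary.Reflects using (det; fromEquivalence; T-reflects)
open import Data.Nat.Tactic.RingSolver using (solve-∀)
open import Relation.Unary using (Pred; Decidable)
open import Algebra.Properties.CommutativeSemigroup +-commutativeSemigroup using () renaming (interchange to +-interchange)
open import Relation.Binary.Definitions using (tri<; tri≈; tri>)
open import Relation.Binary.PropositionalEquality using (refl; sym; trans; cong; cong₂; subst; subst₂; module ≡-Reasoning)

private
  variable
    a : Level
    A B : Set a

∑ : List A → (A → ℕ) → ℕ
∑ xs f = sum (map f xs)

when : Bool → ℕ → ℕ
when b n = if b then n else 0

when-∧ : ∀ b c n → when (b ∧ c) n ≡ when b (when c n)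
when-∧ true  c n = refl
when-∧ false c n = refl

when-comm : ∀ b c n → when b (when c n) ≡ when c (when b n)
when-comm true  c     n = refl
when-comm false true  n = refl
when-comm false false n = refl

T-injective : ∀ {x y} → (T x → T y) → (T y → T x) → x ≡ y
T-injective {y = y} x⇒y y⇒x = det (fromEquivalence x⇒y y⇒x) (T-reflects y)

≡ᵇ-≢ : ∀ {x y} → x ≢ y → (x ≡ᵇ y) ≡ false
≡ᵇ-≢ {x} {y} x≢y = T-injective (x≢y ∘ ≡ᵇ⇒≡ x y) (λ ())


∑-++ : ∀ (xs ys : List A) f → ∑ (xs ++ ys) f ≡ ∑ xs f + ∑ ys f
∑-++ xs ys f = trans (cong sum (map-++ f xs ys)) (sum-++ (map f xs) (map f ys))

∑-map : ∀ (g : A → B) xs f → ∑ (map g xs) f ≡ ∑ xs (f ∘ g)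
∑-map g xs f = cong sum (sym (map-∘ xs))

∑-concatMap : ∀ (g : A → List B) xs f → ∑ (concatMap g xs) f ≡ ∑ xs (λ x → ∑ (g x) f)
∑-concatMap g []       f = refl
∑-concatMap g (x ∷ xs) f = trans (∑-++ (g x) (concatMap g xs) f) (cong (∑ (g x) f +_) (∑-concatMap g xs f))

∑-filter : ∀ {p} {P : Pred A p} (P? : Decidable P) xs f → ∑ (filter P? xs) f ≡ ∑ xs (λ x → when (does (P? x)) (f x))
∑-filter P? []       f = refl
∑-filter P? (x ∷ xs) f with does (P? x)
... | true  = cong (f x +_) (∑-filter P? xs f)
... | false = ∑-filter P? xs f

∑-cong : ∀ (xs : List A) {f g} → (∀ {x} → x ∈ xs → f x ≡ g x) → ∑ xs f ≡ ∑ xs g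
∑-cong []       f≡g = refl
∑-cong (x ∷ xs) f≡g = cong₂ _+_ (f≡g (here refl)) (∑-cong xs (f≡g ∘ there))

∑-zero : ∀ (xs : List A) → ∑ xs (λ _ → 0) ≡ 0
∑-zero []       = refl
∑-zero (x ∷ xs) = ∑-zero xs

∑-one : ∀ (xs : List A) → ∑ xs (λ _ → 1) ≡ length xs
∑-one []       = refl
∑-one (x ∷ xs) = cong suc (∑-one xs)

∑-+ : ∀ (xs : List A) f g → ∑ xs (λ x → f x + g x) ≡ ∑ xs f + ∑ xs g
∑-+ []       f g = refl
∑-+ (x ∷ xs) f g = trans (cong (f x + g x +_) (∑-+ xs f g)) (+-interchange (f x) (g x) _ _)

∑-*ˡ : ∀ (xs : List A) c f → ∑ xs (λ x → c * f x) ≡ c * ∑ xs f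
∑-*ˡ []       c f = sym (*-zeroʳ c)
∑-*ˡ (x ∷ xs) c f = trans (cong (c * f x +_) (∑-*ˡ xs c f)) (sym (*-distribˡ-+ c (f x) _))

∑-*ʳ : ∀ (xs : List A) c f → ∑ xs (λ x → f x * c) ≡ ∑ xs f * c
∑-*ʳ []       c f = refl
∑-*ʳ (x ∷ xs) c f = trans (cong (f x * c +_) (∑-*ʳ xs c f)) (sym (*-distribʳ-+ c (f x) _))

∑-swap : ∀ (xs : List A) (ys : List B) (f : A → B → ℕ) → ∑ xs (λ x → ∑ ys (f x)) ≡ ∑ ys (λ y → ∑ xs (λ x → f x y))
∑-swap []       ys f = sym (∑-zero ys)
∑-swap (x ∷ xs) ys f = trans (cong (∑ ys (f x) +_) (∑-swap xs ys f)) (sym (∑-+ ys (f x) _))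

∑-mono : ∀ (xs : List A) {f g} → (∀ x → f x ≤ g x) → ∑ xs f ≤ ∑ xs g
∑-mono []       f≤g = z≤n
∑-mono (x ∷ xs) f≤g = +-mono-≤ (f≤g x) (∑-mono xs f≤g)

∑-when : ∀ (xs : List A) b f → ∑ xs (λ x → when b (f x)) ≡ when b (∑ xs f)
∑-when xs true  f = refl
∑-when xs false f = ∑-zero xs

∑< : ℕ → (ℕ → ℕ) → ℕ
∑< zero    f = 0
∑< (suc k) f = f 0 + ∑< k (f ∘ suc)

∑-applyUpTo : ∀ (φ : ℕ → A) k f → ∑ (applyUpTo φ k) f ≡ ∑< k (f ∘ φ)
∑-applyUpTo φ zero    f = refl
∑-applyUpTo φ (suc k) f = cong (f (φ 0) +_) (∑-applyUpTo (φ ∘ suc) k f)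

∑<-cong : ∀ k {f g} → (∀ {i} → i < k → f i ≡ g i) → ∑< k f ≡ ∑< k g
∑<-cong zero    f≡g = refl
∑<-cong (suc k) f≡g = cong₂ _+_ (f≡g z<s) (∑<-cong k (f≡g ∘ s<s))

∑<-zero : ∀ k {f} → (∀ {i} → i < k → f i ≡ 0) → ∑< k f ≡ 0
∑<-zero k f≡0 = ∑<-cong k f≡0 ⟨ trans ⟩ ∑<-const-zero k
  where
  ∑<-const-zero : ∀ k → ∑< k (λ _ → 0) ≡ 0
  ∑<-const-zero zero    = refl
  ∑<-const-zero (suc k) = ∑<-const-zero k

∑<-+ : ∀ j k f → ∑< (j + k) f ≡ ∑< j f + ∑< k (λ i → f (j + i))
∑<-+ zero    k f = refl
∑<-+ (suc j) k f = trans (cong (f 0 +_) (∑<-+ j k (f ∘ suc))) (sym (+-assoc (f 0) _ _))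

∑<-suc : ∀ k f → ∑< (suc k) f ≡ ∑< k f + f k
∑<-suc zero    f = +-comm (f 0) 0
∑<-suc (suc k) f = trans (cong (f 0 +_) (∑<-suc k (f ∘ suc))) (sym (+-assoc (f 0) _ _))

∑<-reverse : ∀ k f → ∑< k f ≡ ∑< k (λ i → f (k ∸ suc i))
∑<-reverse zero    f = refl
∑<-reverse (suc k) f = trans (∑<-suc k f) (trans (+-comm (∑< k f) (f k)) (cong (f k +_) (∑<-reverse k f)))

∑<-*ˡ : ∀ k c f → ∑< k (λ i → c * f i) ≡ c * ∑< k f
∑<-*ˡ zero    c f = sym (*-zeroʳ c)
∑<-*ˡ (suc k) c f = trans (cong (c * f 0 +_) (∑<-*ˡ k c (f ∘ suc))) (sym (*-distribˡ-+ c (f 0) _))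

∑<-truncate : ∀ {k K} → k ≤ K → ∀ (f : ℕ → ℕ) → ∑< K (λ i → when (i <ᵇ k) (f i)) ≡ ∑< k f
∑<-truncate {zero}  {K}     _         f = ∑<-zero K (λ _ → refl)
∑<-truncate {suc k} {suc K} (s≤s k≤K) f = cong (f 0 +_) (∑<-truncate k≤K (f ∘ suc))

∑<-delta : ∀ {a K} → a < K → ∀ (f : ℕ → ℕ) → ∑< K (λ i → when (i ≡ᵇ a) (f i)) ≡ f a
∑<-delta {zero}  {suc K} _         f = trans (cong (f 0 +_) (∑<-zero K (λ _ → refl))) (+-identityʳ (f 0))
∑<-delta {suc a} {suc K} (s≤s a<K) f = ∑<-delta a<K (f ∘ suc)

∑-fromTo : ∀ a b f → ∑ (fromTo a b) f ≡ ∑< (suc b ∸ a) (λ i → f (a + i))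
∑-fromTo a b f = trans (∑-map (a +_) (upTo (suc b ∸ a)) f) (∑-applyUpTo (λ i → i) (suc b ∸ a) _)

∈-fromTo⁻ : ∀ {a b i} → i ∈ fromTo a b → a ≤ i × i ≤ b
∈-fromTo⁻ {a} {b} i∈ with ∈-map⁻ (a +_) i∈
... | k , k∈ , refl = m≤m+n a k , ≤-pred (subst (_≤ suc b) (cong suc (+-comm k a)) (m≤o∸n⇒m+n≤o (suc k) a<1+b k<))
  where
  k< : k < suc b ∸ a
  k< = ∈-upTo⁻ k∈
  a<1+b : a ≤ suc b
  a<1+b = <⇒≤ (m∸n≢0⇒n<m (λ eq → n≮0 (subst (k <_) eq k<)))

∈-fromTo⁺ : ∀ {a b i} → a ≤ i → i ≤ b → i ∈ fromTo a b
∈-fromTo⁺ {a} {b} {i} a≤i i≤b = subst (_∈ fromTo a b) (m+[n∸m]≡n a≤i) (∈-map⁺ (a +_) (∈-upTo⁺ i∸a<))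
  where
  i∸a< : i ∸ a < suc b ∸ a
  i∸a< = m+n≤o⇒m≤o∸n (suc (i ∸ a)) (subst (_≤ suc b) (sym (cong suc (m∸n+n≡m a≤i))) (s≤s i≤b))

∑-fromTo-cong : ∀ a b {f g} → (∀ {i} → a ≤ i → i ≤ b → f i ≡ g i) → ∑ (fromTo a b) f ≡ ∑ (fromTo a b) g
∑-fromTo-cong a b f≡g = ∑-cong (fromTo a b) (λ i∈ → let a≤i , i≤b = ∈-fromTo⁻ i∈ in f≡g a≤i i≤b)

∑-fromTo-reflect : ∀ {m H} → m ≤ H → ∀ f → ∑ (fromTo (H ∸ m) H) f ≡ ∑ (fromTo 0 m) (λ l → f (H ∸ l))
∑-fromTo-reflect {m} {H} m≤H f = begin
  ∑ (fromTo (H ∸ m) H) f                 ≡⟨ ∑-fromTo (H ∸ m) H f ⟩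
  ∑< (suc H ∸ (H ∸ m)) (λ i → f (H ∸ m + i)) ≡⟨ cong (λ k → ∑< k (λ i → f (H ∸ m + i))) length≡ ⟩
  ∑< (suc m) (λ i → f (H ∸ m + i))       ≡⟨ ∑<-reverse (suc m) (λ i → f (H ∸ m + i)) ⟩
  ∑< (suc m) (λ i → f (H ∸ m + (m ∸ i))) ≡⟨ ∑<-cong (suc m) (λ {i} i<1+m → cong f (reflect≡ {i} (≤-pred i<1+m))) ⟩
  ∑< (suc m) (λ l → f (H ∸ l))           ≡⟨ sym (∑-fromTo 0 m _) ⟩
  ∑ (fromTo 0 m) (λ l → f (H ∸ l))       ∎
  where
  open ≡-Reasoning
  length≡ : suc H ∸ (H ∸ m) ≡ suc m
  length≡ = trans (+-∸-assoc 1 (m∸n≤m H m)) (cong suc (m∸[m∸n]≡n m≤H))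
  reflect≡ : ∀ {i} → i ≤ m → H ∸ m + (m ∸ i) ≡ H ∸ i
  reflect≡ {i} i≤m = trans (sym (+-∸-assoc (H ∸ m) i≤m)) (cong (_∸ i) (m∸n+n≡m m≤H))

∑-fromTo-delta : ∀ {lo hi a} → lo ≤ a → a ≤ hi → ∀ (f : ℕ → ℕ) →
                 ∑ (fromTo lo hi) (λ k → when (k ≡ᵇ a) (f k)) ≡ f a
∑-fromTo-delta {lo} {hi} {a} lo≤a a≤hi f = begin
  ∑ (fromTo lo hi) (λ k → when (k ≡ᵇ a) (f k))                ≡⟨ ∑-fromTo lo hi _ ⟩
  ∑< (suc hi ∸ lo) (λ i → when (lo + i ≡ᵇ a) (f (lo + i)))
    ≡⟨ ∑<-cong (suc hi ∸ lo) (λ {i} _ → cong (λ b → when b (f (lo + i))) (offset i)) ⟩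
  ∑< (suc hi ∸ lo) (λ i → when (i ≡ᵇ a ∸ lo) (f (lo + i)))     ≡⟨ ∑<-delta a∸lo< (λ i → f (lo + i)) ⟩
  f (lo + (a ∸ lo))                                           ≡⟨ cong f (m+[n∸m]≡n lo≤a) ⟩
  f a                                                         ∎
  where
  open ≡-Reasoning
  offset : ∀ i → (lo + i ≡ᵇ a) ≡ (i ≡ᵇ a ∸ lo)
  offset i = T-injective
    (λ t → ≡⇒≡ᵇ i (a ∸ lo) (trans (sym (m+n∸m≡n lo i)) (cong (_∸ lo) (≡ᵇ⇒≡ (lo + i) a t))))
    (λ t → ≡⇒≡ᵇ (lo + i) a (trans (cong (lo +_) (≡ᵇ⇒≡ i (a ∸ lo) t)) (m+[n∸m]≡n lo≤a)))
  a∸lo< : a ∸ lo < suc hi ∸ lo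
  a∸lo< = subst (a ∸ lo <_) (sym (+-∸-assoc 1 (≤-trans lo≤a a≤hi))) (s≤s (∸-monoˡ-≤ lo a≤hi))

-- Gaussian coefficients

gaussian : ℕ → ℕ → ℕ → ℕ
gaussian q zero    b       = 1
gaussian q (suc a) zero    = 1
gaussian q (suc a) (suc b) = gaussian q a (suc b) + q ^ suc a * gaussian q (suc a) b

gaussian-zeroʳ : ∀ q a → gaussian q a 0 ≡ 1
gaussian-zeroʳ q zero    = refl
gaussian-zeroʳ q (suc a) = refl

gaussian-hockey : ∀ q U t → ∑< (suc U) (λ u → q ^ u * gaussian q u t) ≡ gaussian q U (suc t)
gaussian-hockey q zero    t = refl
gaussian-hockey q (suc U) t =
  trans (∑<-suc (suc U) (λ u → q ^ u * gaussian q u t)) (cong (_+ q ^ suc U * gaussian q (suc U) t) (gaussian-hockey q U t))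

qint-+ : ∀ a b q → qint (a + b) q ≡ qint a q + q ^ a * qint b q
qint-+ a b q = begin
  qint (a + b) q                          ≡⟨ ∑-applyUpTo (λ i → i) (a + b) (q ^_) ⟩
  ∑< (a + b) (q ^_)                       ≡⟨ ∑<-+ a b (q ^_) ⟩
  ∑< a (q ^_) + ∑< b (λ i → q ^ (a + i))
    ≡⟨ cong₂ _+_ (sym (∑-applyUpTo (λ i → i) a (q ^_))) (∑<-cong b (λ {i} _ → ^-distribˡ-+-* q a i)) ⟩
  qint a q + ∑< b (λ i → q ^ a * q ^ i)   ≡⟨ cong (qint a q +_) (∑<-*ˡ b (q ^ a) (q ^_)) ⟩
  qint a q + q ^ a * ∑< b (q ^_)          ≡⟨ cong (λ s → qint a q + q ^ a * s) (sym (∑-applyUpTo (λ i → i) b (q ^_))) ⟩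
  qint a q + q ^ a * qint b q             ∎
  where open ≡-Reasoning

qfact-+ : ∀ a b q → qfact (a + b) q ≡ qfact a q * qfact b q * gaussian q a b
qfact-+ zero    b       q = sym (trans (*-identityʳ (1 * qfact b q)) (*-identityˡ (qfact b q)))
qfact-+ (suc a) zero    q =
  trans (cong (λ k → qfact k q) (+-identityʳ (suc a))) (sym (trans (*-identityʳ _) (*-identityʳ _)))
qfact-+ (suc a) (suc b) q = begin
  qfact (a + suc b) q * qint (suc a + suc b) q
    ≡⟨ cong (qfact (a + suc b) q *_) (qint-+ (suc a) (suc b) q) ⟩
  qfact (a + suc b) q * (qint (suc a) q + q ^ suc a * qint (suc b) q)
    ≡⟨ *-distribˡ-+ (qfact (a + suc b) q) _ _ ⟩
  qfact (a + suc b) q * qint (suc a) q + qfact (a + suc b) q * (q ^ suc a * qint (suc b) q)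
    ≡⟨ cong₂ (λ x y → x * qint (suc a) q + y * (q ^ suc a * qint (suc b) q))
             (qfact-+ a (suc b) q) (trans (cong (λ k → qfact k q) (+-suc a b)) (qfact-+ (suc a) b q)) ⟩
  qfact a q * qfact (suc b) q * gaussian q a (suc b) * qint (suc a) q
    + qfact (suc a) q * qfact b q * gaussian q (suc a) b * (q ^ suc a * qint (suc b) q)
    ≡⟨ regroup (qfact a q) (qfact b q) (qint (suc a) q) (qint (suc b) q) (q ^ suc a) _ _ ⟩
  qfact (suc a) q * qfact (suc b) q * gaussian q (suc a) (suc b) ∎
  where
  open ≡-Reasoning
  regroup : ∀ fa fb ia ib p g₁ g₂ → fa * (fb * ib) * g₁ * ia + fa * ia * fb * g₂ * (p * ib)
                                    ≡ fa * ia * (fb * ib) * (g₁ + p * g₂)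
  regroup = solve-∀

qbinom≡gaussian : ∀ a b q → qbinom (a + b) a q ≡ gaussian q a b
qbinom≡gaussian a b q = divides-exactly {{m*n≢0 _ _ {{qfact≢0 (a + b ∸ a)}} {{qfact≢0 a}}}} (begin
  qfact (a + b) q                                    ≡⟨ qfact-+ a b q ⟩
  qfact a q * qfact b q * gaussian q a b             ≡⟨ rearrange (qfact a q) (qfact b q) (gaussian q a b) ⟩
  gaussian q a b * (qfact b q * qfact a q)           ≡⟨ cong (λ k → gaussian q a b * (qfact k q * qfact a q)) (sym (m+n∸m≡n a b)) ⟩
  gaussian q a b * (qfact (a + b ∸ a) q * qfact a q) ∎)
  where
  open ≡-Reasoning
  rearrange : ∀ x y z → x * y * z ≡ z * (y * x)
  rearrange = solve-∀
  qfact≢0 : ∀ k → NonZero (qfact k q)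
  qfact≢0 k = >-nonZero (qfact-pos k q)
  divides-exactly : ∀ {x y d} .{{_ : NonZero d}} → x ≡ y * d → x / d ≡ y
  divides-exactly {y = y} {d} refl = m*n/n≡m y d

≤∸-swap : ∀ {x y n} → y ≤ n → x ≤ n ∸ y → y ≤ n ∸ x
≤∸-swap {x} {y} {n} y≤n x≤n∸y = m+n≤o⇒m≤o∸n y (subst (_≤ n) (+-comm x y) (m≤o∸n⇒m+n≤o x y≤n x≤n∸y))

gaussian-hockey-above : ∀ q t {c n} → c ≤ n →
  ∑ (fromTo 1 (suc n)) (λ v → when (c <ᵇ v) (q ^ (suc n ∸ v) * gaussian q (suc n ∸ v) t)) ≡ gaussian q (n ∸ c) (suc t)
gaussian-hockey-above q t {c} {n} c≤n = begin
  _                                                        ≡⟨ ∑-fromTo 1 (suc n) _ ⟩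
  ∑< (suc n) (λ i → when (c <ᵇ suc i) (F (n ∸ i)))         ≡⟨ ∑<-reverse (suc n) (λ i → when (c <ᵇ suc i) (F (n ∸ i))) ⟩
  ∑< (suc n) (λ i → when (c <ᵇ suc (n ∸ i)) (F (n ∸ (n ∸ i)))) ≡⟨ ∑<-cong (suc n) reindex ⟩
  ∑< (suc n) (λ i → when (i <ᵇ suc (n ∸ c)) (F i))         ≡⟨ ∑<-truncate (s≤s (m∸n≤m n c)) F ⟩
  ∑< (suc (n ∸ c)) F                                       ≡⟨ gaussian-hockey q (n ∸ c) t ⟩
  gaussian q (n ∸ c) (suc t)                               ∎
  where
  open ≡-Reasoning
  F : ℕ → ℕ
  F u = q ^ u * gaussian q u t
  reindex : ∀ {i} → i < suc n → when (c <ᵇ suc (n ∸ i)) (F (n ∸ (n ∸ i))) ≡ when (i <ᵇ suc (n ∸ c)) (F i)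
  reindex {i} (s≤s i≤n) = cong₂ when
    (T-injective (λ c≤n∸i → <⇒<ᵇ (s≤s (≤∸-swap i≤n (≤-pred (<ᵇ⇒< c _ c≤n∸i)))))
             (λ i≤n∸c → <⇒<ᵇ (s≤s (≤∸-swap c≤n (≤-pred (<ᵇ⇒< i _ i≤n∸c))))))
    (cong F (m∸[m∸n]≡n i≤n))

Letter : ℕ → ℕ → Set
Letter N x = 1 ≤ x × x ≤ N

∈-words⁻ : ∀ k N {w} → w ∈ words k N → length w ≡ k × All (Letter N) w
∈-words⁻ zero    N (here refl) = refl , []
∈-words⁻ (suc k) N w∈ with find (∈-concatMap⁻ (λ a → map (a ∷_) (words k N)) {xs = fromTo 1 N} w∈)
... | a , a∈ , w∈′ with ∈-map⁻ (a ∷_) w∈′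
... | w′ , w′∈ , refl = let len , letters = ∈-words⁻ k N w′∈ in cong suc len , ∈-fromTo⁻ a∈ ∷ letters

∑-words-cong : ∀ k N {f g} → (∀ {w} → length w ≡ k → All (Letter N) w → f w ≡ g w) → ∑ (words k N) f ≡ ∑ (words k N) g
∑-words-cong k N f≡g = ∑-cong (words k N) (λ w∈ → let len , letters = ∈-words⁻ k N w∈ in f≡g len letters)

∑-words-suc : ∀ k N f → ∑ (words (suc k) N) f ≡ ∑ (fromTo 1 N) (λ a → ∑ (words k N) (λ w → f (a ∷ w)))
∑-words-suc k N f = trans (∑-concatMap _ (fromTo 1 N) f) (∑-cong (fromTo 1 N) (λ {a} _ → ∑-map (a ∷_) (words k N) f))

∑-words-snoc : ∀ k N f → ∑ (words (suc k) N) f ≡ ∑ (words k N) (λ w → ∑ (fromTo 1 N) (λ a → f (w ++ [ a ])))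
∑-words-snoc zero    N f =
  trans (∑-words-suc 0 N f) (trans (∑-cong (fromTo 1 N) (λ {a} _ → +-identityʳ (f [ a ]))) (sym (+-identityʳ _)))
∑-words-snoc (suc k) N f = begin
  ∑ (words (suc (suc k)) N) f
    ≡⟨ ∑-words-suc (suc k) N f ⟩
  ∑ (fromTo 1 N) (λ a → ∑ (words (suc k) N) (λ w → f (a ∷ w)))
    ≡⟨ ∑-cong (fromTo 1 N) (λ {a} _ → ∑-words-snoc k N (λ w → f (a ∷ w))) ⟩
  ∑ (fromTo 1 N) (λ a → ∑ (words k N) (λ w → ∑ (fromTo 1 N) (λ b → f (a ∷ w ++ [ b ]))))
    ≡⟨ sym (∑-words-suc k N _) ⟩
  ∑ (words (suc k) N) (λ w → ∑ (fromTo 1 N) (λ b → f (w ++ [ b ]))) ∎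
  where open ≡-Reasoning

punchIn : ℕ → ℕ → ℕ
punchIn v x = if x <ᵇ v then x else suc x

punchIn-suc : ∀ v x → punchIn (suc v) (suc x) ≡ suc (punchIn v x)
punchIn-suc v x with x <ᵇ v
... | true  = refl
... | false = refl

punchIn-<ᵇ : ∀ v x y → (punchIn v x <ᵇ punchIn v y) ≡ (x <ᵇ y)
punchIn-<ᵇ zero    x       y       = refl
punchIn-<ᵇ (suc v) zero    zero    = refl
punchIn-<ᵇ (suc v) zero    (suc y) rewrite punchIn-suc v y = refl
punchIn-<ᵇ (suc v) (suc x) zero    = refl
punchIn-<ᵇ (suc v) (suc x) (suc y) rewrite punchIn-suc v x | punchIn-suc v y = punchIn-<ᵇ v x y

punchIn-mono-< : ∀ v {x y} → x < y → punchIn v x < punchIn v y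
punchIn-mono-< v {x} {y} x<y = <ᵇ⇒< _ _ (subst T (sym (punchIn-<ᵇ v x y)) (<⇒<ᵇ x<y))

punchIn-injective : ∀ v {x y} → punchIn v x ≡ punchIn v y → x ≡ y
punchIn-injective v {x} {y} eq with <-cmp x y
... | tri< x<y _ _ = ⊥-elim (<-irrefl eq (punchIn-mono-< v x<y))
... | tri≈ _ x≡y _ = x≡y
... | tri> _ _ y<x = ⊥-elim (<-irrefl (sym eq) (punchIn-mono-< v y<x))

∑<-skip : ∀ {p n} → p ≤ n → ∀ (ψ : ℕ → ℕ) → ∑< (suc n) (λ i → when (not (i ≡ᵇ p)) (ψ i)) ≡ ∑< n (ψ ∘ punchIn p)
∑<-skip {zero}  {n}     _         ψ = refl
∑<-skip {suc p} {suc n} (s≤s p≤n) ψ =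
  cong (ψ 0 +_) (trans (∑<-skip p≤n (ψ ∘ suc)) (∑<-cong n (λ {i} _ → cong ψ (sym (punchIn-suc p i)))))

∑-fromTo-skip : ∀ {v n} → 1 ≤ v → v ≤ suc n → ∀ (φ : ℕ → ℕ) →
  ∑ (fromTo 1 (suc n)) (λ a → when (not (a ≡ᵇ v)) (φ a)) ≡ ∑ (fromTo 1 n) (φ ∘ punchIn v)
∑-fromTo-skip {suc p} {n} _ (s≤s p≤n) φ = begin
  _                                                   ≡⟨ ∑-fromTo 1 (suc n) _ ⟩
  ∑< (suc n) (λ i → when (not (i ≡ᵇ p)) (φ (suc i)))  ≡⟨ ∑<-skip p≤n (φ ∘ suc) ⟩
  ∑< n (λ i → φ (suc (punchIn p i)))                  ≡⟨ ∑<-cong n (λ {i} _ → cong φ (sym (punchIn-suc p i))) ⟩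
  ∑< n (λ i → φ (punchIn (suc p) (suc i)))            ≡⟨ sym (∑-fromTo 1 n _) ⟩
  ∑ (fromTo 1 n) (φ ∘ punchIn (suc p))                ∎
  where open ≡-Reasoning

avoids : ℕ → List ℕ → Bool
avoids v = all (λ x → not (x ≡ᵇ v))

∑-words-avoiding : ∀ k {n v} → 1 ≤ v → v ≤ suc n → ∀ G →
  ∑ (words k (suc n)) (λ w → when (avoids v w) (G w)) ≡ ∑ (words k n) (G ∘ map (punchIn v))
∑-words-avoiding zero    _   _  G = refl
∑-words-avoiding (suc k) {n} {v} 1≤v v≤1+n G = begin
  ∑ (words (suc k) (suc n)) (λ w → when (avoids v w) (G w))
    ≡⟨ ∑-words-suc k (suc n) _ ⟩
  ∑ (fromTo 1 (suc n)) (λ a → ∑ (words k (suc n)) (λ w → when (not (a ≡ᵇ v) ∧ avoids v w) (G (a ∷ w))))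
    ≡⟨ ∑-cong (fromTo 1 (suc n)) (λ {a} _ → factor a) ⟩
  ∑ (fromTo 1 (suc n)) (λ a → when (not (a ≡ᵇ v)) (∑ (words k (suc n)) (λ w → when (avoids v w) (G (a ∷ w)))))
    ≡⟨ ∑-cong (fromTo 1 (suc n)) (λ {a} _ → cong (when _) (∑-words-avoiding k 1≤v v≤1+n (λ w → G (a ∷ w)))) ⟩
  ∑ (fromTo 1 (suc n)) (λ a → when (not (a ≡ᵇ v)) (∑ (words k n) (λ w → G (a ∷ map (punchIn v) w))))
    ≡⟨ ∑-fromTo-skip 1≤v v≤1+n _ ⟩
  ∑ (fromTo 1 n) (λ b → ∑ (words k n) (λ w → G (punchIn v b ∷ map (punchIn v) w)))
    ≡⟨ sym (∑-words-suc k n _) ⟩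
  ∑ (words (suc k) n) (G ∘ map (punchIn v)) ∎
  where
  open ≡-Reasoning
  factor : ∀ a → ∑ (words k (suc n)) (λ w → when (not (a ≡ᵇ v) ∧ avoids v w) (G (a ∷ w)))
               ≡ when (not (a ≡ᵇ v)) (∑ (words k (suc n)) (λ w → when (avoids v w) (G (a ∷ w))))
  factor a = trans (∑-cong (words k (suc n)) (λ {w} _ → when-∧ (not (a ≡ᵇ v)) (avoids v w) _))
                   (∑-when (words k (suc n)) (not (a ≡ᵇ v)) (λ w → when (avoids v w) (G (a ∷ w))))

uniqueᵇ : List ℕ → Bool
uniqueᵇ w = does (UniqueDec.unique? _≟_ w)

uniqueᵇ⇒Unique : ∀ {w} → T (uniqueᵇ w) → Unique w
uniqueᵇ⇒Unique {w} with UniqueDec.unique? _≟_ w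
... | yes uniq = λ _ → uniq

Unique⇒uniqueᵇ : ∀ {w} → Unique w → T (uniqueᵇ w)
Unique⇒uniqueᵇ {w} uniq with UniqueDec.unique? _≟_ w
... | yes _     = _
... | no ¬uniq = ¬uniq uniq

avoids⇒∉ : ∀ {v} w → T (avoids v w) → v ∉ w
avoids⇒∉ {v} w t = All¬⇒¬Any (All.map (λ {x} x≢v v≡x → subst (T ∘ not) (Equivalence.to T-≡ (≡⇒≡ᵇ x v (sym v≡x))) x≢v)
                                      (all⁺ _ w t))

∉⇒avoids : ∀ {v} w → v ∉ w → T (avoids v w)
∉⇒avoids {v} w v∉w = all⁻ _ (All.map (λ v≢x → subst (T ∘ not) (sym (≡ᵇ-≢ (v≢x ∘ sym))) _) (¬Any⇒All¬ w v∉w))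

unique-snoc⁻ : ∀ w {v : ℕ} → Unique (w ++ [ v ]) → Unique w × v ∉ w
unique-snoc⁻ []      _           = [] , λ ()
unique-snoc⁻ (x ∷ w) (x∉ ∷ uniq) with unique-snoc⁻ w uniq
... | uniq-w , v∉w = ++⁻ˡ w x∉ ∷ uniq-w , λ { (here refl)  → All.head (++⁻ʳ w x∉) refl
                                           ; (there v∈w) → v∉w v∈w }

unique-snoc⁺ : ∀ {w} {v : ℕ} → Unique w → v ∉ w → Unique (w ++ [ v ])
unique-snoc⁺ {w} uniq v∉w = AllPairs.++⁺ uniq ([] ∷ []) (All.tabulate (λ x∈w → (λ { refl → v∉w x∈w }) ∷ []))

uniqueᵇ-snoc : ∀ w v → uniqueᵇ (w ++ [ v ]) ≡ uniqueᵇ w ∧ avoids v w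
uniqueᵇ-snoc w v = T-injective
  (λ t → let uniq , v∉w = unique-snoc⁻ w (uniqueᵇ⇒Unique t)
         in Equivalence.from T-∧ (Unique⇒uniqueᵇ uniq , ∉⇒avoids w v∉w))
  (λ t → let tu , ta = Equivalence.to T-∧ t in Unique⇒uniqueᵇ (unique-snoc⁺ (uniqueᵇ⇒Unique tu) (avoids⇒∉ w ta)))

uniqueᵇ-map-punchIn : ∀ v w → uniqueᵇ (map (punchIn v) w) ≡ uniqueᵇ w
uniqueᵇ-map-punchIn v w = T-injective
  (λ t → Unique⇒uniqueᵇ (Unique.map⁻ (uniqueᵇ⇒Unique {map (punchIn v) w} t)))
  (λ t → Unique⇒uniqueᵇ {map (punchIn v) w} (Unique.map⁺ (punchIn-injective v) (uniqueᵇ⇒Unique t)))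

extend : ℕ → List ℕ → List ℕ
extend v π = map (punchIn v) π ++ [ v ]

at-map : ∀ (f : ℕ → ℕ) π {j} → 1 ≤ j → j ≤ length π → at (map f π) j ≡ f (at π j)
at-map f (x ∷ π) {suc zero}    _ _         = refl
at-map f (x ∷ π) {suc (suc j)} _ (s≤s j≤n) = at-map f π (s≤s z≤n) j≤n

at-++ˡ : ∀ w ys {j} → 1 ≤ j → j ≤ length w → at (w ++ ys) j ≡ at w j
at-++ˡ (x ∷ w) ys {suc zero}    _ _         = refl
at-++ˡ (x ∷ w) ys {suc (suc j)} _ (s≤s j≤n) = at-++ˡ w ys (s≤s z≤n) j≤n

at-++-length : ∀ w {a} ys → at (w ++ a ∷ ys) (suc (length w)) ≡ a
at-++-length []      ys = refl
at-++-length (x ∷ w) ys = at-++-length w ys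

All-at : ∀ {P : Pred ℕ a} {w} → All P w → ∀ {j} → 1 ≤ j → j ≤ length w → P (at w j)
All-at (px ∷ pxs) {suc zero}    _ _         = px
All-at (px ∷ pxs) {suc (suc j)} _ (s≤s j≤n) = All-at pxs (s≤s z≤n) j≤n

Unique-at-suc : ∀ {w} → Unique w → ∀ {k} → 1 ≤ k → suc k ≤ length w → at w k ≢ at w (suc k)
Unique-at-suc ((x≢y ∷ _) ∷ _) {suc zero}    _ _           = x≢y
Unique-at-suc (_ ∷ uniq)      {suc (suc k)} _ (s≤s k+1≤n) = Unique-at-suc uniq (s≤s z≤n) k+1≤n

length-extend : ∀ v π → length (extend v π) ≡ suc (length π)
length-extend v π =
  trans (length-++ (map (punchIn v) π)) (trans (+-comm _ 1) (cong suc (length-map (punchIn v) π)))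

at-extend : ∀ v π {j} → 1 ≤ j → j ≤ length π → at (extend v π) j ≡ punchIn v (at π j)
at-extend v π 1≤j j≤n =
  trans (at-++ˡ (map (punchIn v) π) [ v ] 1≤j (subst (_ ≤_) (sym (length-map (punchIn v) π)) j≤n))
        (at-map (punchIn v) π 1≤j j≤n)

at-extend-last : ∀ v π → at (extend v π) (suc (length π)) ≡ v
at-extend-last v π =
  subst (λ k → at (extend v π) (suc k) ≡ v) (length-map (punchIn v) π) (at-++-length (map (punchIn v) π) [])

-- Inversion numbers

inversions : List ℕ → ℕ
inversions []       = 0
inversions (x ∷ xs) = ∑ xs (λ y → when (y <ᵇ x) 1) + inversions xs

∑-at : ∀ (xs : List ℕ) g → ∑ xs g ≡ ∑< (length xs) (λ k → g (at xs (suc k)))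
∑-at []       g = refl
∑-at (x ∷ xs) g = cong (g x +_) (∑-at xs g)

invCount-∷ : ∀ x xs → invCount (x ∷ xs) ≡ ∑ xs (λ y → when (y <ᵇ x) 1) + invCount xs
invCount-∷ x xs = trans (∑-fromTo 1 (suc L) row) (cong₂ _+_ first-row other-rows)
  where
  L = length xs
  row : ℕ → ℕ
  row i = ∑ (fromTo (suc i) (suc L)) (λ j → when (at (x ∷ xs) j <ᵇ at (x ∷ xs) i) 1)
  first-row : row 1 ≡ ∑ xs (λ y → when (y <ᵇ x) 1)
  first-row = trans (∑-fromTo 2 (suc L) _) (sym (∑-at xs (λ y → when (y <ᵇ x) 1)))
  other-rows : ∑< L (λ i → row (2 + i)) ≡ invCount xs
  other-rows = trans (∑<-cong L (λ {i} _ → trans (∑-fromTo (3 + i) (suc L) _) (sym (∑-fromTo (2 + i) L _))))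
                     (sym (∑-fromTo 1 L _))

invCount≡inversions : ∀ w → invCount w ≡ inversions w
invCount≡inversions []       = refl
invCount≡inversions (x ∷ xs) =
  trans (invCount-∷ x xs) (cong (∑ xs (λ y → when (y <ᵇ x) 1) +_) (invCount≡inversions xs))

inversions-snoc : ∀ w a → inversions (w ++ [ a ]) ≡ inversions w + ∑ w (λ y → when (a <ᵇ y) 1)
inversions-snoc []      a = refl
inversions-snoc (x ∷ w) a = begin
  ∑ (w ++ [ a ]) (λ y → when (y <ᵇ x) 1) + inversions (w ++ [ a ])
    ≡⟨ cong₂ _+_ (∑-++ w [ a ] _) (inversions-snoc w a) ⟩
  ∑ w (λ y → when (y <ᵇ x) 1) + (when (a <ᵇ x) 1 + 0) + (inversions w + ∑ w (λ y → when (a <ᵇ y) 1))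
    ≡⟨ regroup (∑ w (λ y → when (y <ᵇ x) 1)) (when (a <ᵇ x) 1) (inversions w) _ ⟩
  ∑ w (λ y → when (y <ᵇ x) 1) + inversions w + (when (a <ᵇ x) 1 + ∑ w (λ y → when (a <ᵇ y) 1)) ∎
  where
  open ≡-Reasoning
  regroup : ∀ p r s t → p + (r + 0) + (s + t) ≡ p + s + (r + t)
  regroup = solve-∀

inversions-map-punchIn : ∀ v w → inversions (map (punchIn v) w) ≡ inversions w
inversions-map-punchIn v []      = refl
inversions-map-punchIn v (x ∷ w) = cong₂ _+_
  (trans (∑-map (punchIn v) w _) (∑-cong w (λ {y} _ → cong (λ b → when b 1) (punchIn-<ᵇ v y x))))
  (inversions-map-punchIn v w)

<ᵇ-suc : ∀ v y → (v <ᵇ suc y) ≡ (v ≤ᵇ y)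
<ᵇ-suc zero    y = refl
<ᵇ-suc (suc v) y = refl

punchIn-<ᵇ-self : ∀ v y → (v <ᵇ punchIn v y) ≡ (v ≤ᵇ y)
punchIn-<ᵇ-self zero    y       = refl
punchIn-<ᵇ-self (suc v) zero    = refl
punchIn-<ᵇ-self (suc v) (suc y) rewrite punchIn-suc v y = trans (punchIn-<ᵇ-self v y) (sym (<ᵇ-suc v y))

count≥ : ℕ → List ℕ → ℕ
count≥ v π = ∑ π (λ y → when (v ≤ᵇ y) 1)

inversions-extend : ∀ v π → inversions (extend v π) ≡ inversions π + count≥ v π
inversions-extend v π = trans (inversions-snoc (map (punchIn v) π) v) (cong₂ _+_ (inversions-map-punchIn v π)
  (trans (∑-map (punchIn v) π _) (∑-cong π (λ {y} _ → cong (λ b → when b 1) (punchIn-<ᵇ-self v y)))))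

when-≤1 : ∀ b → when b 1 ≤ 1
when-≤1 true  = ≤-refl
when-≤1 false = z≤n

count-≡-≤1 : ∀ c {xs} → Unique xs → ∑ xs (λ y → when (y ≡ᵇ c) 1) ≤ 1
count-≡-≤1 c {[]}     []          = z≤n
count-≡-≤1 c {x ∷ xs} (x∉ ∷ uniq) with x ≡ᵇ c in eq
... | false = count-≡-≤1 c uniq
... | true  = s≤s (≤-reflexive (trans (∑-cong xs (λ y∈ → cong (λ b → when b 1) (≡ᵇ-≢ (All.lookup x∉ y∈ ∘ trans x≡c ∘ sym))))
                                      (∑-zero xs)))
  where
  x≡c : x ≡ c
  x≡c = ≡ᵇ⇒≡ x c (subst T (sym eq) _)

inWindow : ℕ → ℕ → ℕ → Bool
inWindow lo k y = (lo ≤ᵇ y) ∧ (y <ᵇ lo + k)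

inWindow-zero : ∀ lo y → inWindow lo 0 y ≡ false
inWindow-zero lo y = T-injective (λ t → let lo≤y , y<lo+0 = Equivalence.to T-∧ t in
  <-irrefl refl (≤-trans (subst (y <_) (+-identityʳ lo) (<ᵇ⇒< y _ y<lo+0)) (≤ᵇ⇒≤ lo y lo≤y))) (λ ())

inWindow-suc : ∀ lo k y → when (inWindow lo (suc k) y) 1 ≤ when (inWindow lo k y) 1 + when (y ≡ᵇ lo + k) 1
inWindow-suc lo k y with y ≡ᵇ lo + k in eq
... | true  = ≤-trans (when-≤1 _) (m≤n+m 1 _)
... | false = ≤-reflexive (trans (cong (λ b → when ((lo ≤ᵇ y) ∧ b) 1) shrink) (sym (+-identityʳ _)))
  where
  y≢lo+k : y ≢ lo + k
  y≢lo+k y≡lo+k = subst T eq (≡⇒≡ᵇ y (lo + k) y≡lo+k)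
  shrink : (y <ᵇ lo + suc k) ≡ (y <ᵇ lo + k)
  shrink = T-injective
    (λ t → <⇒<ᵇ (≤∧≢⇒< (≤-pred (subst (y <_) (+-suc lo k) (<ᵇ⇒< y _ t))) y≢lo+k))
    (λ t → <⇒<ᵇ (≤-trans (<ᵇ⇒< y _ t) (+-monoʳ-≤ lo (n≤1+n k))))

count-inWindow : ∀ k lo {xs} → Unique xs → ∑ xs (λ y → when (inWindow lo k y) 1) ≤ k
count-inWindow zero    lo {xs} _    =
  ≤-reflexive (trans (∑-cong xs (λ {y} _ → cong (λ b → when b 1) (inWindow-zero lo y))) (∑-zero xs))
count-inWindow (suc k) lo {xs} uniq = begin
  ∑ xs (λ y → when (inWindow lo (suc k) y) 1)                       ≤⟨ ∑-mono xs (inWindow-suc lo k) ⟩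
  ∑ xs (λ y → when (inWindow lo k y) 1 + when (y ≡ᵇ lo + k) 1)      ≡⟨ ∑-+ xs _ _ ⟩
  ∑ xs (λ y → when (inWindow lo k y) 1) + ∑ xs (λ y → when (y ≡ᵇ lo + k) 1)
    ≤⟨ +-mono-≤ (count-inWindow k lo uniq) (count-≡-≤1 (lo + k) uniq) ⟩
  k + 1                                                             ≡⟨ +-comm k 1 ⟩
  suc k                                                             ∎
  where open ≤-Reasoning

≤ᵇ-<ᵇ-partition : ∀ v y → when (v ≤ᵇ y) 1 + when (y <ᵇ v) 1 ≡ 1
≤ᵇ-<ᵇ-partition zero    y       = refl
≤ᵇ-<ᵇ-partition (suc v) zero    = refl
≤ᵇ-<ᵇ-partition (suc v) (suc y) =
  trans (cong (λ b → when b 1 + when (y <ᵇ v) 1) (<ᵇ-suc v y)) (≤ᵇ-<ᵇ-partition v y)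

-- The entries ≥ v are distinct values in [v,n] and those < v distinct values in [1,v-1];
-- since the two counts add up to n, both bounds are attained.
count≥-permutation : ∀ {n v π} → Unique π → All (Letter n) π → length π ≡ n → 1 ≤ v → v ≤ suc n →
  count≥ v π ≡ suc n ∸ v
count≥-permutation {n} {suc v′} {π} uniq letters refl _ v≤1+n = ≤-antisym upper lower
  where
  count< : ℕ
  count< = ∑ π (λ y → when (y <ᵇ suc v′) 1)
  partition : count≥ (suc v′) π + count< ≡ n
  partition = trans (sym (∑-+ π _ _)) (trans (∑-cong π (λ {y} _ → ≤ᵇ-<ᵇ-partition (suc v′) y)) (∑-one π))
  upper : count≥ (suc v′) π ≤ suc n ∸ suc v′
  upper = ≤-trans (≤-reflexive (∑-cong π (λ y∈ → cong (λ b → when b 1) (≥-window (proj₂ (All.lookup letters y∈))))))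
                    (count-inWindow (suc n ∸ suc v′) (suc v′) uniq)
    where
    ≥-window : ∀ {y} → y ≤ n → (suc v′ ≤ᵇ y) ≡ inWindow (suc v′) (suc n ∸ suc v′) y
    ≥-window {y} y≤n = sym (trans (cong (λ k → (suc v′ ≤ᵇ y) ∧ (y <ᵇ k)) (m+[n∸m]≡n v≤1+n))
                                  (trans (cong ((suc v′ ≤ᵇ y) ∧_) (Equivalence.to T-≡ (<⇒<ᵇ (s≤s y≤n))))
                                         (∧-identityʳ _)))
  <-window : ∀ {y} → 1 ≤ y → when (y <ᵇ suc v′) 1 ≡ when (inWindow 1 v′ y) 1
  <-window {suc y} _ = refl
  count<-upper : count< ≤ v′
  count<-upper = ≤-trans (≤-reflexive (∑-cong π (λ y∈ → <-window (proj₁ (All.lookup letters y∈)))))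
                         (count-inWindow v′ 1 uniq)
  lower : suc n ∸ suc v′ ≤ count≥ (suc v′) π
  lower = subst (n ∸ v′ ≤_) (trans (cong (_∸ count<) (sym partition)) (m+n∸n≡m _ count<)) (∸-monoʳ-≤ n count<-upper)

invCount-extend : ∀ {n v π} → Unique π → All (Letter n) π → length π ≡ n → 1 ≤ v → v ≤ suc n →
  invCount (extend v π) ≡ invCount π + (suc n ∸ v)
invCount-extend {n} {v} {π} uniq letters len 1≤v v≤1+n = begin
  invCount (extend v π)        ≡⟨ invCount≡inversions (extend v π) ⟩
  inversions (extend v π)      ≡⟨ inversions-extend v π ⟩
  inversions π + count≥ v π
    ≡⟨ cong₂ _+_ (sym (invCount≡inversions π)) (count≥-permutation uniq letters len 1≤v v≤1+n) ⟩
  invCount π + (suc n ∸ v)     ∎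
  where open ≡-Reasoning

-- h-inversions

∈ᵇ⇒∈ : ∀ {p : ℕ × ℕ} xs → T (p ∈ᵇ xs) → p ∈ xs
∈ᵇ⇒∈ {a , b} xs t = Any.map pair≡ (any⁻ _ xs t)
  where
  pair≡ : ∀ {q} → T (let (c , d) = q in (a ≡ᵇ c) ∧ (b ≡ᵇ d)) → (a , b) ≡ q
  pair≡ {c , d} t′ = let a≡c , b≡d = Equivalence.to T-∧ t′ in cong₂ _,_ (≡ᵇ⇒≡ a c a≡c) (≡ᵇ⇒≡ b d b≡d)

∈⇒∈ᵇ : ∀ {p : ℕ × ℕ} xs → p ∈ xs → T (p ∈ᵇ xs)
∈⇒∈ᵇ {a , b} xs p∈ = any⁺ _ (Any.map (λ { refl → Equivalence.from T-∧ (≡⇒≡ᵇ a a refl , ≡⇒≡ᵇ b b refl) }) p∈)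

sameSet⇒⊆ : ∀ X Y → T (sameSet X Y) → X ⊆ Y × Y ⊆ X
sameSet⇒⊆ X Y t = let X⊆Y , Y⊆X = Equivalence.to T-∧ t in
  (λ p∈ → ∈ᵇ⇒∈ Y (All.lookup (all⁺ _ X X⊆Y) p∈)) , (λ p∈ → ∈ᵇ⇒∈ X (All.lookup (all⁺ _ Y Y⊆X) p∈))

⊆⇒sameSet : ∀ X Y → X ⊆ Y → Y ⊆ X → T (sameSet X Y)
⊆⇒sameSet X Y X⊆Y Y⊆X = Equivalence.from T-∧
  (all⁻ _ (All.tabulate (∈⇒∈ᵇ Y ∘ X⊆Y)) , all⁻ _ (All.tabulate (∈⇒∈ᵇ X ∘ Y⊆X)))

HInversion : (ℕ → ℕ) → List ℕ → ℕ → ℕ → Set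
HInversion h π i j = 1 ≤ i × i < j × j ≤ length π × j ≤ h i × at π j < at π i

∈-invH⁻ : ∀ h π {i j} → (i , j) ∈ invH h π → HInversion h π i j
∈-invH⁻ h π p∈ with find (∈-concatMap⁻ _ {xs = fromTo 1 (length π)} p∈)
... | i , i∈ , p∈′ with find (∈-concatMap⁻ _ {xs = fromTo (suc i) (length π)} p∈′)
... | j , j∈ , p∈″ with (j ≤ᵇ h i) ∧ (at π j <ᵇ at π i) in eq
... | true with p∈″
... | here refl =
  let j≤h[i] , descent = Equivalence.to T-∧ (subst T (sym eq) _)
      i<j , j≤n = ∈-fromTo⁻ j∈
  in proj₁ (∈-fromTo⁻ i∈) , i<j , j≤n , ≤ᵇ⇒≤ j (h i) j≤h[i] , <ᵇ⇒< _ _ descent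

∈-invH⁺ : ∀ h π {i j} → HInversion h π i j → (i , j) ∈ invH h π
∈-invH⁺ h π {i} {j} (1≤i , i<j , j≤n , j≤h[i] , descent) =
  ∈-concatMap⁺ _ (lose (∈-fromTo⁺ 1≤i (≤-trans (<⇒≤ i<j) j≤n))
    (∈-concatMap⁺ _ (lose (∈-fromTo⁺ i<j j≤n) here-if)))
  where
  here-if : (i , j) ∈ (if (j ≤ᵇ h i) ∧ (at π j <ᵇ at π i) then (i , j) ∷ [] else [])
  here-if rewrite Equivalence.to T-≡ (Equivalence.from T-∧ (≤⇒≤ᵇ j≤h[i] , <⇒<ᵇ descent)) = here refl

module _ (h : ℕ → ℕ) (v : ℕ) (π : List ℕ) where

  HInversion-extend⁺ : ∀ {i j} → HInversion h π i j → HInversion h (extend v π) i j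
  HInversion-extend⁺ (1≤i , i<j , j≤n , j≤h[i] , descent) =
    1≤i , i<j , ≤-trans j≤n (≤-trans (n≤1+n _) (≤-reflexive (sym (length-extend v π)))) , j≤h[i] ,
    subst₂ _<_ (sym (at-extend v π (≤-trans 1≤i (<⇒≤ i<j)) j≤n)) (sym (at-extend v π 1≤i (≤-trans (<⇒≤ i<j) j≤n)))
           (punchIn-mono-< v descent)

  HInversion-extend⁻ : ∀ {i j} → HInversion h (extend v π) i j → j ≤ length π → HInversion h π i j
  HInversion-extend⁻ (1≤i , i<j , _ , j≤h[i] , descent) j≤n =
    1≤i , i<j , j≤n , j≤h[i] ,
    <ᵇ⇒< _ _ (subst T (punchIn-<ᵇ v _ _) (<⇒<ᵇ (subst₂ _<_ (at-extend v π (≤-trans 1≤i (<⇒≤ i<j)) j≤n)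
                                                          (at-extend v π 1≤i (≤-trans (<⇒≤ i<j) j≤n)) descent)))

  HInversion-extend-last⁻ : ∀ {i} → HInversion h (extend v π) i (suc (length π)) →
                            i ≤ length π × suc (length π) ≤ h i × v ≤ at π i
  HInversion-extend-last⁻ (1≤i , s≤s i≤n , _ , n+1≤h[i] , descent) = i≤n , n+1≤h[i] ,
    ≤ᵇ⇒≤ v _ (subst T (punchIn-<ᵇ-self v (at π _))
                      (<⇒<ᵇ (subst₂ _<_ (at-extend-last v π) (at-extend v π 1≤i i≤n) descent)))

  HInversion-extend-last⁺ : ∀ {i} → 1 ≤ i → i ≤ length π → suc (length π) ≤ h i → v ≤ at π i →
                            HInversion h (extend v π) i (suc (length π))
  HInversion-extend-last⁺ 1≤i i≤n n+1≤h[i] v≤π[i] =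
    1≤i , s≤s i≤n , ≤-reflexive (sym (length-extend v π)) , n+1≤h[i] ,
    subst₂ _<_ (sym (at-extend-last v π)) (sym (at-extend v π 1≤i i≤n))
           (<ᵇ⇒< _ _ (subst T (sym (punchIn-<ᵇ-self v (at π _))) (≤⇒≤ᵇ v≤π[i])))

-- Permutations with inv_h(π) = S

module Admissible
  (h : ℕ → ℕ) (h-mono : ∀ i j → 1 ≤ i → i ≤ j → h i ≤ h j) (h-inc : ∀ i → 1 ≤ i → i < h i)
  (S : List (ℕ × ℕ)) (m : ℕ) (1≤m : 1 ≤ m) (m-max : ∀ i → (i , suc i) ∈ S → i ≤ m) where

  inIh : List ℕ → Bool
  inIh π = sameSet (invH h π) S

  H : ℕ
  H = h m

  m<H : m < H
  m<H = h-inc m 1≤m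

  1≤H : 1 ≤ H
  1≤H = ≤-trans 1≤m (<⇒≤ m<H)

  no-descent-after-m : ∀ {π k} → T (inIh π) → m < k → suc k ≤ length π → at π k ≤ at π (suc k)
  no-descent-after-m {π} {k} π∈I m<k k+1≤n with at π (suc k) <? at π k
  ... | no  ¬descent = ≮⇒≥ ¬descent
  ... | yes descent  =
    ⊥-elim (<⇒≱ m<k (m-max k (inv⊆S (∈-invH⁺ h π (1≤k , ≤-refl , k+1≤n , h-inc k 1≤k , descent)))))
    where
    1≤k : 1 ≤ k
    1≤k = ≤-trans (s≤s z≤n) m<k
    inv⊆S : invH h π ⊆ S
    inv⊆S = proj₁ (sameSet⇒⊆ (invH h π) S π∈I)

  nondecreasing-after-m : ∀ {π i j} → T (inIh π) → m < i → i ≤ j → j ≤ length π → at π i ≤ at π j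
  nondecreasing-after-m {π} {i} π∈I m<i i≤j = go (≤⇒≤′ i≤j)
    where
    go : ∀ {j} → i ≤′ j → j ≤ length π → at π i ≤ at π j
    go ≤′-refl           _     = ≤-refl
    go (≤′-step i≤′j) j+1≤n =
      ≤-trans (go i≤′j (<⇒≤ j+1≤n)) (no-descent-after-m {π} π∈I (<-≤-trans m<i (≤′⇒≤ i≤′j)) j+1≤n)

  S-bounded : ∀ {π i j} → T (inIh π) → (i , j) ∈ S → j ≤ H
  S-bounded {π} {i} {j} π∈I ij∈S with ∈-invH⁻ h π (proj₂ (sameSet⇒⊆ (invH h π) S π∈I) ij∈S) | i ≤? m
  ... | 1≤i , _   , _   , j≤h[i] , _       | yes i≤m = ≤-trans j≤h[i] (h-mono i m 1≤i i≤m)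
  ... | _   , i<j , j≤n , _      , descent | no  i≰m =
    ⊥-elim (<⇒≱ descent (nondecreasing-after-m {π} π∈I (≰⇒> i≰m) (<⇒≤ i<j) j≤n))

  inIh-extend⁻ : ∀ {v π} → H ≤ length π → T (inIh (extend v π)) → T (inIh π) × at π (length π) < v
  inIh-extend⁻ {v} {π} H≤n ext∈I = ⊆⇒sameSet (invH h π) S inv⊆S S⊆inv , last<v
    where
    n = length π
    1≤n : 1 ≤ n
    1≤n = ≤-trans 1≤H H≤n
    inv[ext]⊆S : invH h (extend v π) ⊆ S
    inv[ext]⊆S = proj₁ (sameSet⇒⊆ (invH h (extend v π)) S ext∈I)
    inv⊆S : invH h π ⊆ S
    inv⊆S ij∈ = inv[ext]⊆S (∈-invH⁺ h (extend v π) (HInversion-extend⁺ h v π (∈-invH⁻ h π ij∈)))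
    S⊆inv[ext] : S ⊆ invH h (extend v π)
    S⊆inv[ext] = proj₂ (sameSet⇒⊆ (invH h (extend v π)) S ext∈I)
    S⊆inv : S ⊆ invH h π
    S⊆inv ij∈S = ∈-invH⁺ h π (HInversion-extend⁻ h v π (∈-invH⁻ h (extend v π) (S⊆inv[ext] ij∈S))
                                                   (≤-trans (S-bounded {extend v π} ext∈I ij∈S) H≤n))
    last<v : at π n < v
    last<v with at π n <? v
    ... | yes π[n]<v = π[n]<v
    ... | no  π[n]≮v =
      ⊥-elim (1+n≰n (≤-trans (S-bounded {extend v π} ext∈I (inv[ext]⊆S (∈-invH⁺ h (extend v π) last-inversion))) H≤n))
      where
      last-inversion : HInversion h (extend v π) n (suc n)
      last-inversion = HInversion-extend-last⁺ h v π 1≤n ≤-refl (h-inc n 1≤n) (≮⇒≥ π[n]≮v)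

  no-HInversion-into-last : ∀ {v π i} → H ≤ length π → T (inIh π) → at π (length π) < v →
                            ¬ HInversion h (extend v π) i (suc (length π))
  no-HInversion-into-last {v} {π} {i} H≤n π∈I last<v inv with HInversion-extend-last⁻ h v π inv | i ≤? m
  ... | _   , n+1≤h[i] , _      | yes i≤m = 1+n≰n (≤-trans n+1≤h[i] (≤-trans (h-mono i m (proj₁ inv) i≤m) H≤n))
  ... | i≤n , _        , v≤π[i] | no  i≰m =
    <⇒≱ last<v (≤-trans v≤π[i] (nondecreasing-after-m {π} π∈I (≰⇒> i≰m) i≤n ≤-refl))

  inIh-extend⁺ : ∀ {v π} → H ≤ length π → T (inIh π) → at π (length π) < v → T (inIh (extend v π))
  inIh-extend⁺ {v} {π} H≤n π∈I last<v = ⊆⇒sameSet (invH h (extend v π)) S inv⊆S S⊆inv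
    where
    S⊆inv[π] : S ⊆ invH h π
    S⊆inv[π] = proj₂ (sameSet⇒⊆ (invH h π) S π∈I)
    S⊆inv : S ⊆ invH h (extend v π)
    S⊆inv ij∈S = ∈-invH⁺ h (extend v π) (HInversion-extend⁺ h v π (∈-invH⁻ h π (S⊆inv[π] ij∈S)))
    inv⊆S : invH h (extend v π) ⊆ S
    inv⊆S {i , j} ij∈ with ∈-invH⁻ h (extend v π) ij∈ | j ≤? length π
    ... | inv | yes j≤n = proj₁ (sameSet⇒⊆ (invH h π) S π∈I) (∈-invH⁺ h π (HInversion-extend⁻ h v π inv j≤n))
    ... | inv | no  j≰n with ≤-antisym (subst (j ≤_) (length-extend v π) (proj₁ (proj₂ (proj₂ inv)))) (≰⇒> j≰n)
    ...   | refl = ⊥-elim (no-HInversion-into-last {v} {π} H≤n π∈I last<v inv)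

  inIh-extend : ∀ v π → H ≤ length π → inIh (extend v π) ≡ inIh π ∧ (at π (length π) <ᵇ v)
  inIh-extend v π H≤n = T-injective
    (λ t → let π∈I , last<v = inIh-extend⁻ {v} {π} H≤n t in Equivalence.from T-∧ (π∈I , <⇒<ᵇ last<v))
    (λ t → let π∈I , last<v = Equivalence.to T-∧ t in inIh-extend⁺ {v} {π} H≤n π∈I (<ᵇ⇒< _ _ last<v))

  at-after-m-≥ : ∀ {π k} → T (inIh π) → Unique π → All (Letter (length π)) π →
                 m < k → k ≤ length π → k ∸ m ≤ at π k
  at-after-m-≥ {π} π∈I uniq letters m<k₀ = go (≤⇒≤′ m<k₀)
    where
    go : ∀ {k} → suc m ≤′ k → k ≤ length π → k ∸ m ≤ at π k
    go ≤′-refl             k≤n   = subst (_≤ at π (suc m)) (sym (m+n∸n≡m 1 m)) (proj₁ (All-at letters (s≤s z≤n) k≤n))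
    go (≤′-step {k} m<′k) k+1≤n = begin
      suc k ∸ m     ≡⟨ +-∸-assoc 1 (<⇒≤ m<k) ⟩
      suc (k ∸ m)   ≤⟨ s≤s (go m<′k (<⇒≤ k+1≤n)) ⟩
      suc (at π k)  ≤⟨ ≤∧≢⇒< (no-descent-after-m {π} π∈I m<k k+1≤n)
                             (Unique-at-suc uniq (≤-trans (s≤s z≤n) m<k) k+1≤n) ⟩
      at π (suc k)  ∎
      where
      open ≤-Reasoning
      m<k : m < k
      m<k = ≤′⇒≤ m<′k

module Expansion
  (h : ℕ → ℕ) (h-mono : ∀ i j → 1 ≤ i → i ≤ j → h i ≤ h j) (h-inc : ∀ i → 1 ≤ i → i < h i)
  (S : List (ℕ × ℕ)) (m : ℕ) (1≤m : 1 ≤ m) (m-max : ∀ i → (i , suc i) ∈ S → i ≤ m) (q : ℕ) where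

  open Admissible h h-mono h-inc S m 1≤m m-max

  -- weighted Φ N = Σ_{π ∈ I_h(S,N)} q^ℓ(π) Φ(π_N), summed over all words so that the
  -- uniqueness and h-inversion conditions become indicators.
  term : (ℕ → ℕ) → ℕ → List ℕ → ℕ
  term Φ N π = when (uniqueᵇ π) (when (inIh π) (q ^ invCount π * Φ (at π N)))

  weighted : (ℕ → ℕ) → ℕ → ℕ
  weighted Φ N = ∑ (words N N) (term Φ N)

  weighted-cong : ∀ {Φ Ψ} n → 1 ≤ n → (∀ {c} → 1 ≤ c → c ≤ n → Φ c ≡ Ψ c) → weighted Φ n ≡ weighted Ψ n
  weighted-cong n 1≤n Φ≡Ψ = ∑-words-cong n n (λ {π} len letters →
    let 1≤c , c≤n = All-at letters 1≤n (≤-reflexive (sym len))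
    in cong (λ x → when (uniqueᵇ π) (when (inIh π) (q ^ invCount π * x))) (Φ≡Ψ 1≤c c≤n))

  ∑-Ih : ∀ N (f : List ℕ → ℕ) → ∑ (Ih h S N) f ≡ ∑ (words N N) (λ π → when (uniqueᵇ π) (when (inIh π) (f π)))
  ∑-Ih N f =
    trans (∑-filter (λ π → Bool._≟_ (inIh π) true) (Sn N) f)
    (trans (∑-filter (UniqueDec.unique? _≟_) (words N N) _)
           (∑-cong (words N N) (λ {π} _ → cong (when (uniqueᵇ π)) (does-≟-true (inIh π)))))
    where
    does-≟-true : ∀ b {x} → when (does (Bool._≟_ b true)) x ≡ when b x
    does-≟-true true  = refl
    does-≟-true false = refl

  IhPoly≡weighted : ∀ n → IhPoly h S n q ≡ weighted (λ _ → 1) n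
  IhPoly≡weighted n = trans (∑-Ih n (λ π → q ^ invCount π))
    (∑-cong (words n n) (λ {π} _ → cong (λ x → when (uniqueᵇ π) (when (inIh π) x)) (sym (*-identityʳ _))))

  snocTerm : (ℕ → ℕ) → ℕ → List ℕ → ℕ
  snocTerm Φ v w = when (uniqueᵇ w) (when (inIh (w ++ [ v ])) (q ^ invCount (w ++ [ v ]) * Φ v))

  term-snoc : ∀ Φ {n} w v → length w ≡ n → term Φ (suc n) (w ++ [ v ]) ≡ when (avoids v w) (snocTerm Φ v w)
  term-snoc Φ w v refl rewrite uniqueᵇ-snoc w v | at-++-length w {v} [] =
    trans (when-∧ (uniqueᵇ w) (avoids v w) _) (when-comm (uniqueᵇ w) (avoids v w) _)

  snocTerm-extend : ∀ Φ {n} π v → length π ≡ n → H ≤ n → All (Letter n) π → 1 ≤ v → v ≤ suc n →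
    snocTerm Φ v (map (punchIn v) π)
      ≡ when (uniqueᵇ π) (when (inIh π) (q ^ invCount π * when (at π n <ᵇ v) (q ^ (suc n ∸ v) * Φ v)))
  snocTerm-extend Φ {n} π v refl H≤n letters 1≤v v≤1+n =
    trans (cong₂ (λ u i → when u (when i (q ^ invCount (extend v π) * Φ v)))
                 (uniqueᵇ-map-punchIn v π) (inIh-extend v π H≤n))
          (guarded (uniqueᵇ π) (inIh π) (at π n <ᵇ v) {Y = q ^ invCount π} {Z = q ^ (suc n ∸ v) * Φ v}
                   (λ u _ → weight u))
    where
    open ≡-Reasoning
    weight : T (uniqueᵇ π) → q ^ invCount (extend v π) * Φ v ≡ q ^ invCount π * (q ^ (suc n ∸ v) * Φ v)
    weight u = begin
      q ^ invCount (extend v π) * Φ v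
        ≡⟨ cong (λ e → q ^ e * Φ v) (invCount-extend (uniqueᵇ⇒Unique u) letters refl 1≤v v≤1+n) ⟩
      q ^ (invCount π + (suc n ∸ v)) * Φ v     ≡⟨ cong (_* Φ v) (^-distribˡ-+-* q (invCount π) (suc n ∸ v)) ⟩
      q ^ invCount π * q ^ (suc n ∸ v) * Φ v   ≡⟨ *-assoc (q ^ invCount π) _ _ ⟩
      q ^ invCount π * (q ^ (suc n ∸ v) * Φ v) ∎
    guarded : ∀ u i c {X Y Z} → (T u → T c → X ≡ Y * Z) → when u (when (i ∧ c) X) ≡ when u (when i (Y * when c Z))
    guarded false i     c     _   = refl
    guarded true  false c     _   = refl
    guarded true  true  false {Y = Y} _ = sym (*-zeroʳ Y)
    guarded true  true  true  X≡YZ = X≡YZ _ _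

  weighted-suc : ∀ Φ n → H ≤ n →
    weighted Φ (suc n) ≡ weighted (λ c → ∑ (fromTo 1 (suc n)) (λ v → when (c <ᵇ v) (q ^ (suc n ∸ v) * Φ v))) n
  weighted-suc Φ n H≤n = begin
    weighted Φ (suc n)
      ≡⟨ ∑-words-snoc n (suc n) (term Φ (suc n)) ⟩
    ∑ (words n (suc n)) (λ w → ∑ range (λ v → term Φ (suc n) (w ++ [ v ])))
      ≡⟨ ∑-words-cong n (suc n) (λ {w} len _ → ∑-cong range (λ {v} _ → term-snoc Φ w v len)) ⟩
    ∑ (words n (suc n)) (λ w → ∑ range (λ v → when (avoids v w) (snocTerm Φ v w)))
      ≡⟨ ∑-swap (words n (suc n)) range _ ⟩
    ∑ range (λ v → ∑ (words n (suc n)) (λ w → when (avoids v w) (snocTerm Φ v w)))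
      ≡⟨ ∑-fromTo-cong 1 (suc n) (λ {v} 1≤v v≤1+n → ∑-words-avoiding n 1≤v v≤1+n (snocTerm Φ v)) ⟩
    ∑ range (λ v → ∑ (words n n) (λ π → snocTerm Φ v (map (punchIn v) π)))
      ≡⟨ ∑-fromTo-cong 1 (suc n) (λ {v} 1≤v v≤1+n →
           ∑-words-cong n n (λ {π} len letters → snocTerm-extend Φ π v len H≤n letters 1≤v v≤1+n)) ⟩
    ∑ range (λ v → ∑ (words n n) (λ π → when (uniqueᵇ π) (when (inIh π) (q ^ invCount π * Ψ (at π n) v))))
      ≡⟨ ∑-swap range (words n n) _ ⟩
    ∑ (words n n) (λ π → ∑ range (λ v → when (uniqueᵇ π) (when (inIh π) (q ^ invCount π * Ψ (at π n) v))))
      ≡⟨ ∑-cong (words n n) (λ {π} _ → factor π) ⟩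
    weighted (λ c → ∑ range (Ψ c)) n ∎
    where
    open ≡-Reasoning
    range : List ℕ
    range = fromTo 1 (suc n)
    Ψ : ℕ → ℕ → ℕ
    Ψ c v = when (c <ᵇ v) (q ^ (suc n ∸ v) * Φ v)
    factor : ∀ π → ∑ range (λ v → when (uniqueᵇ π) (when (inIh π) (q ^ invCount π * Ψ (at π n) v)))
                 ≡ term (λ c → ∑ range (Ψ c)) n π
    factor π = trans (∑-when range (uniqueᵇ π) _) (cong (when (uniqueᵇ π))
                 (trans (∑-when range (inIh π) _) (cong (when (inIh π)) (∑-*ˡ range (q ^ invCount π) (Ψ (at π n))))))

  gaussianFrom : ℕ → ℕ → ℕ → ℕ
  gaussianFrom N t x = gaussian q (N ∸ x) t

  weighted-shift : ∀ n t → H ≤ n → weighted (gaussianFrom (suc n) t) (suc n) ≡ weighted (gaussianFrom n (suc t)) n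
  weighted-shift n t H≤n = trans (weighted-suc (gaussianFrom (suc n) t) n H≤n)
                                 (weighted-cong n (≤-trans 1≤H H≤n) (λ _ c≤n → gaussian-hockey-above q t c≤n))

  weighted-descend : ∀ d t → weighted (gaussianFrom (H + d) t) (H + d) ≡ weighted (gaussianFrom H (t + d)) H
  weighted-descend zero    t rewrite +-identityʳ H | +-identityʳ t = refl
  weighted-descend (suc d) t rewrite +-suc H d | +-suc t d =
    trans (weighted-shift (H + d) t (m≤m+n H d)) (weighted-descend d (suc t))

  bk≡∑ : ∀ k → bk h S m k q
             ≡ ∑ (words H H) (λ π → when (uniqueᵇ π) (when (inIh π) (when (k ≡ᵇ at π H) (q ^ invCount π))))
  bk≡∑ k = trans (∑-filter (λ π → k ≟ at π H) (Ih h S H) _) (∑-Ih H _)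

  weighted-at-H : ∀ t → weighted (gaussianFrom H t) H
                        ≡ ∑ (fromTo (H ∸ m) H) (λ k → bk h S m k q * gaussian q (H ∸ k) t)
  weighted-at-H t = sym (begin
    ∑ (fromTo (H ∸ m) H) (λ k → bk h S m k q * g k)
      ≡⟨ ∑-cong (fromTo (H ∸ m) H) (λ {k} _ → trans (cong (_* g k) (bk≡∑ k)) (sym (∑-*ʳ (words H H) (g k) (bTerm k)))) ⟩
    ∑ (fromTo (H ∸ m) H) (λ k → ∑ (words H H) (λ π → bTerm k π * g k))
      ≡⟨ ∑-swap (fromTo (H ∸ m) H) (words H H) _ ⟩
    ∑ (words H H) (λ π → ∑ (fromTo (H ∸ m) H) (λ k → bTerm k π * g k))
      ≡⟨ ∑-words-cong H H (λ {π} len letters → collapse π len letters) ⟩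
    weighted (gaussianFrom H t) H ∎)
    where
    open ≡-Reasoning
    g : ℕ → ℕ
    g k = gaussian q (H ∸ k) t
    bTerm : ℕ → List ℕ → ℕ
    bTerm k π = when (uniqueᵇ π) (when (inIh π) (when (k ≡ᵇ at π H) (q ^ invCount π)))
    collapse : ∀ π → length π ≡ H → All (Letter H) π →
               ∑ (fromTo (H ∸ m) H) (λ k → bTerm k π * g k) ≡ term (gaussianFrom H t) H π
    collapse π len letters with uniqueᵇ π in u | inIh π in i
    ... | false | _     = ∑-zero (fromTo (H ∸ m) H)
    ... | true  | false = ∑-zero (fromTo (H ∸ m) H)
    ... | true  | true  = trans (∑-cong (fromTo (H ∸ m) H) (λ {k} _ → when-*ʳ (k ≡ᵇ at π H) _ (g k)))
                                (∑-fromTo-delta H∸m≤π[H] π[H]≤H (λ k → q ^ invCount π * g k))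
      where
      when-*ʳ : ∀ b x y → when b x * y ≡ when b (x * y)
      when-*ʳ true  x y = refl
      when-*ʳ false x y = refl
      H≤n : H ≤ length π
      H≤n = ≤-reflexive (sym len)
      π[H]≤H : at π H ≤ H
      π[H]≤H = proj₂ (All-at letters 1≤H H≤n)
      H∸m≤π[H] : H ∸ m ≤ at π H
      H∸m≤π[H] = at-after-m-≥ {π} (subst T (sym i) _) (uniqueᵇ⇒Unique (subst T (sym u) _))
                   (subst (λ N → All (Letter N) π) (sym len) letters) m<H H≤n

  expansion : ∀ n → H ≤ n →
              IhPoly h S n q ≡ sumFromTo (H ∸ m) H (λ k → bk h S m k q * qbinom (n ∸ k) (H ∸ k) q)
  expansion n H≤n with m≤n⇒∃[o]m+o≡n H≤n
  ... | d , refl = begin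
    IhPoly h S (H + d) q
      ≡⟨ IhPoly≡weighted (H + d) ⟩
    weighted (λ _ → 1) (H + d)
      ≡⟨ weighted-cong (H + d) (≤-trans 1≤H H≤n) (λ {c} _ _ → sym (gaussian-zeroʳ q (H + d ∸ c))) ⟩
    weighted (gaussianFrom (H + d) 0) (H + d)
      ≡⟨ weighted-descend d 0 ⟩
    weighted (gaussianFrom H d) H
      ≡⟨ weighted-at-H d ⟩
    ∑ (fromTo (H ∸ m) H) (λ k → bk h S m k q * gaussian q (H ∸ k) d)
      ≡⟨ ∑-fromTo-cong (H ∸ m) H (λ {k} _ k≤H → cong (bk h S m k q *_) (as-qbinom k≤H)) ⟩
    sumFromTo (H ∸ m) H (λ k → bk h S m k q * qbinom (H + d ∸ k) (H ∸ k) q) ∎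
    where
    open ≡-Reasoning
    as-qbinom : ∀ {k} → k ≤ H → gaussian q (H ∸ k) d ≡ qbinom (H + d ∸ k) (H ∸ k) q
    as-qbinom {k} k≤H =
      sym (trans (cong (λ x → qbinom x (H ∸ k) q) (+-∸-comm d k≤H)) (qbinom≡gaussian (H ∸ k) d q))

  reindexing : ∀ n → H ≤ n → sumFromTo (H ∸ m) H (λ k → bk h S m k q * qbinom (n ∸ k) (H ∸ k) q)
                            ≡ sumFromTo 0 m (λ l → bk h S m (H ∸ l) q * qbinom (n ∸ H + l) l q)
  reindexing n H≤n = trans (∑-fromTo-reflect (<⇒≤ m<H) _) (∑-fromTo-cong 0 m (λ {l} _ l≤m →
    let l≤H = ≤-trans l≤m (<⇒≤ m<H) in
    cong₂ (λ x y → bk h S m (H ∸ l) q * qbinom x y q) (∸-reflect l≤H) (m∸[m∸n]≡n l≤H)))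
    where
    ∸-reflect : ∀ {l} → l ≤ H → n ∸ (H ∸ l) ≡ n ∸ H + l
    ∸-reflect {l} l≤H = trans (cong (_∸ (H ∸ l)) (sym (m∸n+n≡m H≤n)))
                        (trans (+-∸-assoc (n ∸ H) (m∸n≤m H l)) (cong (n ∸ H +_) (m∸[m∸n]≡n l≤H)))

theorem5p4 : (h : ℕ → ℕ)
    → (∀ i j → 1 ≤ i → i ≤ j → h i ≤ h j)
    → (∀ i → 1 ≤ i → i < h i)
    → (S : List (ℕ × ℕ))
    → S ≢ []
    → Σ ℕ (λ N → Σ (List ℕ) (λ σ → (σ ∈ Sn N) × T (sameSet (invH h σ) S)))
    → (m : ℕ)
    → (m , suc m) ∈ S
    → (∀ i → (i , suc i) ∈ S → i ≤ m)
    → (n : ℕ) → h m ≤ n → (q : ℕ)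
    → (IhPoly h S n q
         ≡ sumFromTo (h m ∸ m) (h m) (λ k → bk h S m k q * qbinom (n ∸ k) (h m ∸ k) q))
      × (sumFromTo (h m ∸ m) (h m) (λ k → bk h S m k q * qbinom (n ∸ k) (h m ∸ k) q)
         ≡ sumFromTo 0 m (λ l → bk h S m (h m ∸ l) q * qbinom (n ∸ h m + l) l q))
theorem5p4 h h-mono h-inc S _ (_ , σ , _ , σ∈I) m m∈S m-max n H≤n q = expansion n H≤n , reindexing n H≤n
  where
  -- Admissibility of S (and S ≢ []) is only needed to see that m ≥ 1.
  1≤m : 1 ≤ m
  1≤m = proj₁ (∈-invH⁻ h σ (proj₂ (sameSet⇒⊆ (invH h σ) S σ∈I) m∈S))
  open Expansion h h-mono h-inc S m 1≤m m-max q
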